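{- Let $p$ be an odd integer $\ge3$. Then $a_{\mathrm{dbl}}(L)$ satisfies \[a_{\mathrm{dbl}}(L)=p\,a_{\mathrm{dbl}}(L-1)-\tfrac{p-1}{2}\,a_{\mathrm{dbl}}(L-2)\quad(L\ge2),\] whose characteristic roots are $\lambda_{1,2}=\bigl(p\pm\sqrt{(p-1)^2+1}\bigr)/2$. For $p=2$, $a_{\mathrm{dbl}}(L)=2^L$.
   Context: For base $p$ and a digit string $(d_1,\dots,d_L)\in\{0,\dots,p-1\}^L$ (the base-$p$ digits of $m\in[0,p^L)$, least significant first), set $\sigma_0=0$ and $\sigma_j=\lfloor(2d_j+\sigma_{j-1})/p\rfloor$. The doubling of $m$ is cascade-free if there is no $j$ with $2d_j=p-1$ and $\sigma_{j-1}=1$. $a_{\mathrm{dbl}}(L)$ is the number of $m\in[0,p^L)$ whose doubling is cascade-free. -}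

module Defs where

open import Data.Nat using (ℕ; zero; suc; _+_; _*_; _∸_; _^_; NonZero; _≡ᵇ_)
open import Data.Nat.DivMod using (_/_; _%_)
open import Data.Bool using (Bool; true; false; _∧_; not)
open import Data.List using (List; []; _∷_; length; filterᵇ; upTo)

digits : (p : ℕ) → .{{_ : NonZero p}} → ℕ → ℕ → List ℕ
digits p zero    m = []
digits p (suc L) m = (m % p) ∷ digits p L (m / p)

-- Scan the digit string with the doubling carry σ (σ_0 = 0,
-- σ_j = ⌊(2 d_j + σ_{j-1}) / p⌋); fails iff some j has 2 d_j = p-1
-- and σ_{j-1} = 1.
cascadeFreeFrom : (p : ℕ) → .{{_ : NonZero p}} → ℕ → List ℕ → Bool
cascadeFreeFrom p σ []       = true
cascadeFreeFrom p σ (d ∷ ds) =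
  not ((2 * d ≡ᵇ p ∸ 1) ∧ (σ ≡ᵇ 1)) ∧ cascadeFreeFrom p ((2 * d + σ) / p) ds

cascadeFree : (p : ℕ) → .{{_ : NonZero p}} → List ℕ → Bool
cascadeFree p ds = cascadeFreeFrom p 0 ds

aDbl : (p : ℕ) → .{{_ : NonZero p}} → ℕ → ℕ
aDbl p L = length (filterᵇ (λ m → cascadeFree p (digits p L m)) (upTo (p ^ L)))

{-# OPTIONS --safe #-}
module Submission where

open import Defs
open import Data.Nat using (ℕ; zero; suc; _+_; _*_; _∸_; _^_; _≤_; _<_; z≤n; s≤s; _≡ᵇ_; NonZero)
open import Data.Nat.Properties
open import Data.Nat.DivMod using (_/_; _%_; m/n≡1+[m∸n]/n; m<n⇒m/n≡0; m<n⇒m%n≡m; [m+n]%n≡m%n; m*n/n≡m)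
open import Data.Nat.Divisibility using (_∣_; _∣0; ∣-refl; ∣m∣n⇒∣m+n)
open import Data.Nat.Tactic.RingSolver using (solve-∀)
open import Algebra.Properties.CommutativeSemigroup +-commutativeSemigroup using (interchange; x∙yz≈yx∙z)
open import Data.Bool using (Bool; true; false; _∧_; not; if_then_else_)
open import Data.Bool.Properties using (∧-zeroʳ; ∧-identityʳ)
open import Data.List using ([]; _∷_; length; filterᵇ; applyUpTo)
open import Data.Product using (_×_; _,_; ∃-syntax)
open import Function using (_∘_; id)
open import Relation.Nullary using (¬_; contradiction)
open import Relation.Nullary.Decidable using (dec-true; dec-false)
open import Relation.Binary.PropositionalEquality
  using (_≡_; _≢_; refl; sym; trans; cong; cong₂; module ≡-Reasoning)

-- Reading the digits from the least significant one, the doubling carry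
-- is always 0 or 1, so cascade-free strings are counted by a two-state
-- transfer system.  For p = 2h + 1, from carry 0 every digit is allowed:
-- the h + 1 digits d ≤ h keep carry 0 and the h digits d > h produce
-- carry 1.  From carry 1 the digit h is forbidden, the h digits d < h give
-- carry 0 and the h digits d > h keep carry 1.  Hence the counts X (from
-- carry 0) and Y (from carry 1) satisfy X' = (h+1) X + h Y and
-- Y' = h X + h Y, and eliminating Y gives X'' + h X = p X'.  In base 2
-- no digit satisfies 2 d = 1, so nothing is ever forbidden.

sumBelow : ℕ → (ℕ → ℕ) → ℕ
sumBelow zero    f = 0
sumBelow (suc n) f = f 0 + sumBelow n (f ∘ suc)

count : ℕ → (ℕ → Bool) → ℕ
count n P = sumBelow n (λ m → if P m then 1 else 0)

sumBelow-cong : ∀ n {f g : ℕ → ℕ} → (∀ {m} → m < n → f m ≡ g m) →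
                sumBelow n f ≡ sumBelow n g
sumBelow-cong zero    f≡g = refl
sumBelow-cong (suc n) f≡g = cong₂ _+_ (f≡g (s≤s z≤n)) (sumBelow-cong n (f≡g ∘ s≤s))

sumBelow-const : ∀ n c → sumBelow n (λ _ → c) ≡ n * c
sumBelow-const zero    c = refl
sumBelow-const (suc n) c = cong (c +_) (sumBelow-const n c)

sumBelow-constant : ∀ n {f : ℕ → ℕ} {c} → (∀ {m} → m < n → f m ≡ c) →
                    sumBelow n f ≡ n * c
sumBelow-constant n {c = c} f≡c = trans (sumBelow-cong n f≡c) (sumBelow-const n c)

sumBelow-+ : ∀ k l (f : ℕ → ℕ) →
             sumBelow (k + l) f ≡ sumBelow k f + sumBelow l (λ m → f (k + m))
sumBelow-+ zero    l f = refl
sumBelow-+ (suc k) l f =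
  trans (cong (f 0 +_) (sumBelow-+ k l (f ∘ suc))) (sym (+-assoc (f 0) _ _))

sumBelow-distrib : ∀ n (f g : ℕ → ℕ) →
                   sumBelow n (λ m → f m + g m) ≡ sumBelow n f + sumBelow n g
sumBelow-distrib zero    f g = refl
sumBelow-distrib (suc n) f g =
  trans (cong ((f 0 + g 0) +_) (sumBelow-distrib n (f ∘ suc) (g ∘ suc)))
        (interchange (f 0) (g 0) _ _)

sumBelow-comm : ∀ k l (F : ℕ → ℕ → ℕ) →
                sumBelow k (λ i → sumBelow l (F i)) ≡ sumBelow l (λ j → sumBelow k (λ i → F i j))
sumBelow-comm zero    l F = sym (trans (sumBelow-const l 0) (*-zeroʳ l))
sumBelow-comm (suc k) l F =
  trans (cong (sumBelow l (F 0) +_) (sumBelow-comm k l (F ∘ suc)))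
        (sym (sumBelow-distrib l (F 0) _))

[n+m]/n≡1+m/n : ∀ n m .{{_ : NonZero n}} → (n + m) / n ≡ suc (m / n)
[n+m]/n≡1+m/n n m =
  trans (m/n≡1+[m∸n]/n (m≤m+n n m)) (cong (λ k → suc (k / n)) (m+n∸m≡n n m))

sumBelow-divMod : ∀ p .{{_ : NonZero p}} N (F : ℕ → ℕ → ℕ) →
                  sumBelow (p * N) (λ m → F (m % p) (m / p)) ≡
                  sumBelow N (λ q → sumBelow p (λ d → F d q))
sumBelow-divMod p zero    F = cong (λ n → sumBelow n (λ m → F (m % p) (m / p))) (*-zeroʳ p)
sumBelow-divMod p (suc N) F = begin
  sumBelow (p * suc N) G
    ≡⟨ cong (λ n → sumBelow n G) (*-suc p N) ⟩
  sumBelow (p + p * N) G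
    ≡⟨ sumBelow-+ p (p * N) G ⟩
  sumBelow p G + sumBelow (p * N) (λ m → G (p + m))
    ≡⟨ cong₂ _+_ (sumBelow-cong p first-block) (sumBelow-cong (p * N) (λ _ → later-blocks _)) ⟩
  sumBelow p (λ d → F d 0) + sumBelow (p * N) (λ m → F (m % p) (suc (m / p)))
    ≡⟨ cong (sumBelow p (λ d → F d 0) +_) (sumBelow-divMod p N (λ d q → F d (suc q))) ⟩
  sumBelow p (λ d → F d 0) + sumBelow N (λ q → sumBelow p (λ d → F d (suc q)))
    ∎
  where
  open ≡-Reasoning
  G : ℕ → ℕ
  G m = F (m % p) (m / p)
  first-block : ∀ {d} → d < p → G d ≡ F d 0
  first-block d<p = cong₂ F (m<n⇒m%n≡m d<p) (m<n⇒m/n≡0 d<p)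
  later-blocks : ∀ m → G (p + m) ≡ F (m % p) (suc (m / p))
  later-blocks m =
    cong₂ F (trans (cong (_% p) (+-comm p m)) ([m+n]%n≡m%n m p)) ([n+m]/n≡1+m/n p m)

count-∧ : ∀ n b (P : ℕ → Bool) → count n (λ m → b ∧ P m) ≡ (if b then count n P else 0)
count-∧ n true  P = refl
count-∧ n false P = trans (sumBelow-const n 0) (*-zeroʳ n)

length-filterᵇ-applyUpTo : ∀ (P : ℕ → Bool) f n →
                           length (filterᵇ P (applyUpTo f n)) ≡ count n (P ∘ f)
length-filterᵇ-applyUpTo P f zero = refl
length-filterᵇ-applyUpTo P f (suc n) with P (f 0)
... | true  = cong suc (length-filterᵇ-applyUpTo P (f ∘ suc) n)
... | false = length-filterᵇ-applyUpTo P (f ∘ suc) n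

module Carries (p : ℕ) .{{_ : NonZero p}} where

  admissible : ℕ → ℕ → Bool
  admissible σ d = not ((2 * d ≡ᵇ p ∸ 1) ∧ (σ ≡ᵇ 1))

  carry : ℕ → ℕ → ℕ
  carry σ d = (2 * d + σ) / p

  cascadeFreeCount : ℕ → ℕ → ℕ
  cascadeFreeCount σ L = count (p ^ L) (λ m → cascadeFreeFrom p σ (digits p L m))

  countAfterDigit : ℕ → ℕ → ℕ → ℕ
  countAfterDigit σ L d = if admissible σ d then cascadeFreeCount (carry σ d) L else 0

  aDbl≡cascadeFreeCount : ∀ L → aDbl p L ≡ cascadeFreeCount 0 L
  aDbl≡cascadeFreeCount L = length-filterᵇ-applyUpTo _ id (p ^ L)

  -- m < p^(L+1) is read as its lowest digit m % p followed by the L digits of m / p.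
  cascadeFreeCount-suc : ∀ σ L → cascadeFreeCount σ (suc L) ≡ sumBelow p (countAfterDigit σ L)
  cascadeFreeCount-suc σ L = begin
    sumBelow (p * p ^ L) (λ m → F (m % p) (m / p))
      ≡⟨ sumBelow-divMod p (p ^ L) F ⟩
    sumBelow (p ^ L) (λ q → sumBelow p (λ d → F d q))
      ≡⟨ sumBelow-comm (p ^ L) p (λ q d → F d q) ⟩
    sumBelow p (λ d → count (p ^ L) (λ q → admissible σ d ∧ cascadeFreeFrom p (carry σ d) (digits p L q)))
      ≡⟨ sumBelow-cong p (λ {d} _ → count-∧ (p ^ L) (admissible σ d) _) ⟩
    sumBelow p (countAfterDigit σ L)
      ∎
    where
    open ≡-Reasoning
    F : ℕ → ℕ → ℕ
    F d q = if cascadeFreeFrom p σ (d ∷ digits p L q) then 1 else 0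

  countAfterDigit-admissible : ∀ σ d {τ} L → admissible σ d ≡ true → carry σ d ≡ τ →
                               countAfterDigit σ L d ≡ cascadeFreeCount τ L
  countAfterDigit-admissible σ d L adm refl rewrite adm = refl

  countAfterDigit-blocked : ∀ σ d L → admissible σ d ≡ false → countAfterDigit σ L d ≡ 0
  countAfterDigit-blocked σ d L blk rewrite blk = refl

  admissible-0 : ∀ d → admissible 0 d ≡ true
  admissible-0 d = cong not (∧-zeroʳ _)

module OddBase (h : ℕ) where

  p : ℕ
  p = suc (2 * h)

  open Carries p

  X Y : ℕ → ℕ
  X = cascadeFreeCount 0
  Y = cascadeFreeCount 1

  admissible-1 : ∀ {d} → d ≢ h → admissible 1 d ≡ true
  admissible-1 {d} d≢h =
    cong not (trans (∧-identityʳ _) (dec-false (2 * d ≟ 2 * h) (d≢h ∘ *-cancelˡ-≡ d h 2)))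

  admissible-1-middle : admissible 1 h ≡ false
  admissible-1-middle = cong not (trans (∧-identityʳ _) (dec-true (2 * h ≟ 2 * h) refl))

  2*d+σ<2*h : ∀ {σ d} → σ ≤ 1 → d < h → 2 * d + σ < 2 * h
  2*d+σ<2*h {σ} {d} σ≤1 d<h = begin-strict
    2 * d + σ   ≤⟨ +-monoʳ-≤ (2 * d) σ≤1 ⟩
    2 * d + 1   ≡⟨ +-comm (2 * d) 1 ⟩
    suc (2 * d) <⟨ n<1+n _ ⟩
    2 + 2 * d   ≡⟨ *-suc 2 d ⟨
    2 * suc d   ≤⟨ *-monoʳ-≤ 2 d<h ⟩
    2 * h       ∎
    where open ≤-Reasoning

  carry-lower : ∀ {σ d} → σ ≤ 1 → d < h → carry σ d ≡ 0
  carry-lower σ≤1 d<h = m<n⇒m/n≡0 (m<n⇒m<1+n (2*d+σ<2*h σ≤1 d<h))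

  carry-middle : carry 0 h ≡ 0
  carry-middle = m<n⇒m/n≡0 (s≤s (≤-reflexive (+-identityʳ (2 * h))))

  carry-upper : ∀ {σ m} → σ ≤ 1 → m < h → carry σ (suc (h + m)) ≡ 1
  carry-upper {σ} {m} σ≤1 m<h = begin
    (2 * suc (h + m) + σ) / p ≡⟨ cong (_/ p) (upper-digit h m σ) ⟩
    (p + suc (2 * m + σ)) / p ≡⟨ [n+m]/n≡1+m/n p _ ⟩
    suc (suc (2 * m + σ) / p) ≡⟨ cong suc (m<n⇒m/n≡0 (s≤s (2*d+σ<2*h σ≤1 m<h))) ⟩
    1                         ∎
    where
    open ≡-Reasoning
    upper-digit : ∀ h m σ → 2 * suc (h + m) + σ ≡ suc (2 * h) + suc (2 * m + σ)
    upper-digit = solve-∀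

  sumBelow-split-at-h : ∀ (f : ℕ → ℕ) →
               sumBelow p f ≡ sumBelow h f + (f h + sumBelow h (λ m → f (suc (h + m))))
  sumBelow-split-at-h f = begin
    sumBelow (suc (2 * h)) f
      ≡⟨ cong (λ n → sumBelow n f) (p≡h+[1+h] h) ⟩
    sumBelow (h + suc h) f
      ≡⟨ sumBelow-+ h (suc h) f ⟩
    sumBelow h f + (f (h + 0) + sumBelow h (λ m → f (h + suc m)))
      ≡⟨ cong (λ x → sumBelow h f + (f x + sumBelow h (λ m → f (h + suc m)))) (+-identityʳ h) ⟩
    sumBelow h f + (f h + sumBelow h (λ m → f (h + suc m)))
      ≡⟨ cong (λ s → sumBelow h f + (f h + s)) (sumBelow-cong h (λ {m} _ → cong f (+-suc h m))) ⟩
    sumBelow h f + (f h + sumBelow h (λ m → f (suc (h + m))))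
      ∎
    where
    open ≡-Reasoning
    p≡h+[1+h] : ∀ h → suc (2 * h) ≡ h + suc h
    p≡h+[1+h] = solve-∀

  X-suc : ∀ L → X (suc L) ≡ suc h * X L + h * Y L
  X-suc L = begin
    X (suc L)
      ≡⟨ cascadeFreeCount-suc 0 L ⟩
    sumBelow p T
      ≡⟨ sumBelow-split-at-h T ⟩
    sumBelow h T + (T h + sumBelow h (λ m → T (suc (h + m))))
      ≡⟨ cong₂ _+_ (sumBelow-constant h lower) (cong₂ _+_ middle (sumBelow-constant h upper)) ⟩
    h * X L + (X L + h * Y L)
      ≡⟨ x∙yz≈yx∙z (h * X L) (X L) (h * Y L) ⟩
    suc h * X L + h * Y L
      ∎
    where
    open ≡-Reasoning
    T : ℕ → ℕ
    T = countAfterDigit 0 L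
    lower : ∀ {d} → d < h → T d ≡ X L
    lower {d} d<h = countAfterDigit-admissible 0 d L (admissible-0 d) (carry-lower z≤n d<h)
    middle : T h ≡ X L
    middle = countAfterDigit-admissible 0 h L (admissible-0 h) carry-middle
    upper : ∀ {m} → m < h → T (suc (h + m)) ≡ Y L
    upper {m} m<h = countAfterDigit-admissible 0 (suc (h + m)) L (admissible-0 (suc (h + m))) (carry-upper z≤n m<h)

  Y-suc : ∀ L → Y (suc L) ≡ h * X L + h * Y L
  Y-suc L = begin
    Y (suc L)
      ≡⟨ cascadeFreeCount-suc 1 L ⟩
    sumBelow p T
      ≡⟨ sumBelow-split-at-h T ⟩
    sumBelow h T + (T h + sumBelow h (λ m → T (suc (h + m))))
      ≡⟨ cong₂ _+_ (sumBelow-constant h lower) (cong₂ _+_ middle (sumBelow-constant h upper)) ⟩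
    h * X L + h * Y L
      ∎
    where
    open ≡-Reasoning
    T : ℕ → ℕ
    T = countAfterDigit 1 L
    lower : ∀ {d} → d < h → T d ≡ X L
    lower {d} d<h = countAfterDigit-admissible 1 d L (admissible-1 (<⇒≢ d<h)) (carry-lower ≤-refl d<h)
    middle : T h ≡ 0
    middle = countAfterDigit-blocked 1 h L admissible-1-middle
    upper : ∀ {m} → m < h → T (suc (h + m)) ≡ Y L
    upper {m} m<h = countAfterDigit-admissible 1 (suc (h + m)) L
                      (admissible-1 (>⇒≢ (s≤s (m≤m+n h m)))) (carry-upper ≤-refl m<h)

  X-recurrence : ∀ L → X (2 + L) + h * X L ≡ p * X (1 + L)
  X-recurrence L rewrite X-suc (suc L) | Y-suc L | X-suc L = eliminate-Y h (X L) (Y L)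
    where
    eliminate-Y : ∀ h x y → suc h * (suc h * x + h * y) + h * (h * x + h * y) + h * x ≡
                            suc (2 * h) * (suc h * x + h * y)
    eliminate-Y = solve-∀

  [p∸1]/2≡h : (p ∸ 1) / 2 ≡ h
  [p∸1]/2≡h = trans (cong (_/ 2) (*-comm 2 h)) (m*n/n≡m h 2)

  aDbl-recurrence : ∀ L → 2 ≤ L → aDbl p L + ((p ∸ 1) / 2) * aDbl p (L ∸ 2) ≡ p * aDbl p (L ∸ 1)
  aDbl-recurrence (suc (suc L)) (s≤s (s≤s _))
    rewrite [p∸1]/2≡h
          | aDbl≡cascadeFreeCount (2 + L) | aDbl≡cascadeFreeCount L | aDbl≡cascadeFreeCount (1 + L)
    = X-recurrence L

  discriminant : p * p ∸ 4 * ((p ∸ 1) / 2) ≡ (p ∸ 1) ^ 2 + 1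
  discriminant rewrite [p∸1]/2≡h = trans (cong (_∸ 4 * h) (square h)) (m+n∸n≡m _ (4 * h))
    where
    square : ∀ h → suc (2 * h) * suc (2 * h) ≡ 2 * h * (2 * h * 1) + 1 + 4 * h
    square = solve-∀

odd⇒≡1+2* : ∀ n → ¬ 2 ∣ n → ∃[ h ] n ≡ suc (2 * h)
odd⇒≡1+2* zero          2∤n = contradiction (2 ∣0) 2∤n
odd⇒≡1+2* (suc zero)    2∤n = 0 , refl
odd⇒≡1+2* (suc (suc n)) 2∤n with odd⇒≡1+2* n (2∤n ∘ ∣m∣n⇒∣m+n ∣-refl)
... | h , refl = suc h , cong suc (sym (*-suc 2 h))

cascadeFreeFrom-2 : ∀ σ ds → cascadeFreeFrom 2 σ ds ≡ true
cascadeFreeFrom-2 σ []       = refl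
cascadeFreeFrom-2 σ (d ∷ ds) rewrite dec-false (2 * d ≟ 1) (even≢odd d 0) = cascadeFreeFrom-2 _ ds

aDbl-2 : ∀ L → aDbl 2 L ≡ 2 ^ L
aDbl-2 L = begin
  aDbl 2 L
    ≡⟨ Carries.aDbl≡cascadeFreeCount 2 L ⟩
  count (2 ^ L) (λ m → cascadeFree 2 (digits 2 L m))
    ≡⟨ sumBelow-constant (2 ^ L) (λ {m} _ → cong (if_then 1 else 0) (cascadeFreeFrom-2 0 (digits 2 L m))) ⟩
  2 ^ L * 1
    ≡⟨ *-identityʳ (2 ^ L) ⟩
  2 ^ L
    ∎
  where open ≡-Reasoning

theorem5p1 : ((p : ℕ) → .{{_ : NonZero p}} → 3 ≤ p → ¬ (2 ∣ p) →
                ((L : ℕ) → 2 ≤ L →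
                   aDbl p L + ((p ∸ 1) / 2) * aDbl p (L ∸ 2) ≡ p * aDbl p (L ∸ 1))
                × (p * p ∸ 4 * ((p ∸ 1) / 2) ≡ (p ∸ 1) ^ 2 + 1))
           × ((L : ℕ) → aDbl 2 L ≡ 2 ^ L)
theorem5p1 = odd-case , aDbl-2
  where
  odd-case : (p : ℕ) → .{{_ : NonZero p}} → 3 ≤ p → ¬ (2 ∣ p) →
             ((L : ℕ) → 2 ≤ L → aDbl p L + ((p ∸ 1) / 2) * aDbl p (L ∸ 2) ≡ p * aDbl p (L ∸ 1))
             × (p * p ∸ 4 * ((p ∸ 1) / 2) ≡ (p ∸ 1) ^ 2 + 1)
  odd-case p _ 2∤p with odd⇒≡1+2* p 2∤p
  ... | h , refl = OddBase.aDbl-recurrence h , OddBase.discriminant h
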